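{- Every 2-connected graph has an even number of elimination trees.
   Context: A graph is 2-connected if it has at least three vertices and removing any single vertex leaves a connected graph. An elimination tree for a connected graph $G$ is a rooted tree on its vertex set consisting of a root $x$ whose children are the roots of elimination trees for the connected components of $G-x$ (children are unordered). -}

module Defs where

open import Data.Nat using (ℕ; _≤_)
open import Data.Bool using (Bool; true; false)
open import Data.Fin using (Fin)
open import Data.Fin.Subset using (Subset; _∈_; _∉_; _⊆_; _-_; ⊤)
open import Data.Maybe using (Maybe; just; nothing)
open import Data.Vec using (Vec; lookup)
open import Data.Product using (Σ; ∃; _×_)
open import Relation.Binary.PropositionalEquality using (_≡_)
open import Relation.Nullary using (¬_)

record Graph (n : ℕ) : Set where
  field
    adj   : Fin n → Fin n → Bool
    sym   : ∀ u v → adj u v ≡ adj v u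
    irrefl : ∀ v → adj v v ≡ false
open Graph public

module _ {n : ℕ} (G : Graph n) where

  data Reach (S : Subset n) : Fin n → Fin n → Set where
    here : ∀ {u} → u ∈ S → Reach S u u
    step : ∀ {u w v} → u ∈ S → adj G u w ≡ true → Reach S w v → Reach S u v

  Connected : Subset n → Set
  Connected S = ∀ u v → u ∈ S → v ∈ S → Reach S u v

  IsComponent : Subset n → Subset n → Set
  IsComponent S C =
    C ⊆ S × (∃ λ v → v ∈ C) × Connected C ×
    (∀ u v → u ∈ C → v ∈ S → v ∉ C → adj G u v ≡ false)

  TwoConnected : Set
  TwoConnected = 3 ≤ n × (∀ x → Connected (⊤ - x))

  -- Rooted trees on Fin n are encoded by parent vectors: entry v is
  -- 'nothing' if v is the root, and 'just u' if u is the parent of v.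
  ParentVec : Set
  ParentVec = Vec (Maybe (Fin n)) n

  -- ET S r p : the restriction of p to S is an elimination tree of the
  -- connected graph G[S] with root r (the parent entry of r itself is
  -- left unconstrained; it is fixed by the caller).
  data ET (S : Subset n) (r : Fin n) (p : ParentVec) : Set where
    node : r ∈ S →
           (∀ C → IsComponent (S - r) C →
              Σ (Fin n) λ c → c ∈ C × lookup p c ≡ just r × ET C c p) →
           ET S r p

  ElimTree : ParentVec → Set
  ElimTree p = Σ (Fin n) λ r → lookup p r ≡ nothing × ET ⊤ r p

{-# OPTIONS --safe #-}
module Submission where

-- In a 2-connected graph G - r is connected for every vertex r, so the root r of an elimination
-- tree has exactly one child c, and the subtree at c is an elimination tree of G - r.  Swapping
-- r and c (c becomes the root, r its only child, and r adopts the children of c) gives another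
-- elimination tree, because the components of G - r - c do not depend on which of r and c is
-- removed first.  This swap is a fixed-point-free involution on the elimination trees, so there
-- is an even number of them.

open import Defs hiding (sym)
open import Data.Bool using (true; false; if_then_else_)
import Data.Bool.Properties as Bool
open import Data.Empty using (⊥-elim)
open import Data.Fin using (Fin; zero; suc; _≟_)
open import Data.Fin.Properties using (any?; all?)
open import Data.Fin.Subset using (Subset; ⊤; _-_; _─_; _⊆_; _⊂_; outside; ⁅_⁆)
  renaming (_∈_ to _∈ₛ_; _∉_ to _∉ₛ_)
open import Data.Fin.Subset.Induction using (⊂-wellFounded)
open import Data.Fin.Subset.Properties
  using (_∈?_; _⊆?_; anySubset?; ∈⊤; x∈⁅x⁆; p─q⊆p; x∈p∧x≢y⇒x∈p-y; x∈p⇒p-x⊂p; ⊆-⊂-trans; ⊆-antisym;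
         p─x─y≡p─y─x)
open import Data.List using (List; []; _∷_; length; filter; deduplicate; cartesianProductWith; map; allFin)
open import Data.List.Properties using (filter-accept; filter-reject; filter-all)
import Data.List.Relation.Unary.All as All
open import Data.List.Relation.Unary.Any using (here; there)
open import Data.List.Relation.Unary.AllPairs using (_∷_)
open import Data.List.Relation.Unary.Unique.Propositional using (Unique)
open import Data.List.Relation.Unary.Unique.Propositional.Properties using (filter⁺)
open import Data.List.Relation.Unary.Unique.DecPropositional.Properties using (deduplicate-!)
open import Data.List.Membership.Propositional using (_∈_)
open import Data.List.Membership.Propositional.Properties
  using (∈-filter⁺; ∈-filter⁻; ∈-cartesianProductWith⁺; ∈-map⁺; ∈-allFin; ∈-deduplicate⁺)
open import Data.Maybe using (Maybe; just; nothing)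
import Data.Maybe.Properties as Maybe
open import Data.Nat using (ℕ; zero; suc; _≤_; s≤s)
open import Data.Nat.Divisibility using (_∣_; _∣0; ∣-refl; ∣m∣n⇒∣m+n)
open import Data.Nat.Properties using (suc-injective; ≤-trans; n≤1+n)
open import Data.Product using (Σ; ∃; ∃₂; _×_; _,_; proj₁; proj₂)
open import Data.Sum using (_⊎_; inj₁; inj₂; [_,_]′)
open import Data.Vec using (Vec; []; _∷_; lookup; tabulate; here; there)
import Data.Vec.Properties as Vec
open import Data.Vec.Properties
  using (lookup∘tabulate; tabulate∘lookup; tabulate-cong; []=⇒lookup; lookup⇒[]=)
open import Function using (_∘_; _$_; id; const)
open import Induction.WellFounded using (Acc; acc)
open import Relation.Binary.Definitions using (DecidableEquality)
open import Relation.Binary.PropositionalEquality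
  using (_≡_; _≢_; refl; sym; trans; cong; subst; ≢-sym; module ≡-Reasoning)
open import Relation.Nullary using (Dec; yes; no; ¬?; does)
open import Relation.Nullary.Decidable using (map′; _×-dec_; _→-dec_; decidable-stable; dec-true; dec-false)

module _ {A : Set} (_≟ᴬ_ : DecidableEquality A) where

  remove : A → List A → List A
  remove a = filter (λ x → ¬? (x ≟ᴬ a))

  ∈-remove⁺ : ∀ {a x xs} → x ∈ xs → x ≢ a → x ∈ remove a xs
  ∈-remove⁺ {a} = ∈-filter⁺ (λ x → ¬? (x ≟ᴬ a))

  ∈-remove⁻ : ∀ {a x} xs → x ∈ remove a xs → x ∈ xs × x ≢ a
  ∈-remove⁻ {a} xs = ∈-filter⁻ (λ x → ¬? (x ≟ᴬ a)) {xs = xs}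

  length-remove : ∀ {a xs} → Unique xs → a ∈ xs → length xs ≡ suc (length (remove a xs))
  length-remove {a} {x ∷ xs} (x∉xs ∷ _) (here refl) =
    cong (suc ∘ length) (sym (trans (filter-reject (λ y → ¬? (y ≟ᴬ a)) (λ x≢x → x≢x refl))
                                     (filter-all (λ y → ¬? (y ≟ᴬ a)) (All.map ≢-sym x∉xs))))
  length-remove {a} {x ∷ xs} (x∉xs ∷ u) (there a∈xs) =
    cong suc (trans (length-remove u a∈xs)
                    (cong length (sym (filter-accept (λ y → ¬? (y ≟ᴬ a)) (All.lookup x∉xs a∈xs)))))

  -- The length is a parameter so that the recursion, which removes the pair {x, f x}, is structural.
  involution-2∣length : (f : A → A) → ∀ k {xs} → length xs ≡ k → Unique xs →
                        (∀ {x} → x ∈ xs → f x ∈ xs) →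
                        (∀ {x} → x ∈ xs → f (f x) ≡ x) →
                        (∀ {x} → x ∈ xs → f x ≢ x) →
                        2 ∣ k
  involution-2∣length f zero          {[]}        _ _ _ _ _ = 2 ∣0
  involution-2∣length f zero          {_ ∷ _}     ()
  involution-2∣length f (suc _)       {[]}        ()
  involution-2∣length f (suc zero)    {_ ∷ _ ∷ _} ()
  involution-2∣length f (suc zero)    {x ∷ []}    _ _ closed _ noFix with closed (here refl)
  ... | here fx≡x = ⊥-elim (noFix (here refl) fx≡x)
  involution-2∣length f (suc (suc k)) {x ∷ xs} len (x∉xs ∷ u) closed inv noFix =
    ∣m∣n⇒∣m+n ∣-refl (involution-2∣length f k len′ (filter⁺ _ u) closed′
                                           (inv ∘ there ∘ ∈xs) (noFix ∘ there ∘ ∈xs))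
    where
      fx∈xs : f x ∈ xs
      fx∈xs with closed (here refl)
      ... | here fx≡x = ⊥-elim (noFix (here refl) fx≡x)
      ... | there fx∈xs = fx∈xs
      ys : List A
      ys = remove (f x) xs
      ∈xs : ∀ {y} → y ∈ ys → y ∈ xs
      ∈xs = proj₁ ∘ ∈-remove⁻ xs
      len′ : length ys ≡ k
      len′ = suc-injective (trans (sym (length-remove u fx∈xs)) (suc-injective len))
      injective : ∀ {y z} → y ∈ x ∷ xs → z ∈ x ∷ xs → f y ≡ f z → y ≡ z
      injective y∈ z∈ fy≡fz = trans (sym (inv y∈)) (trans (cong f fy≡fz) (inv z∈))
      closed′ : ∀ {y} → y ∈ ys → f y ∈ ys
      closed′ y∈ys with ∈-remove⁻ xs y∈ys
      ... | y∈xs , y≢fx with closed (there y∈xs)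
      ...   | here fy≡x =
              ⊥-elim (y≢fx (injective (there y∈xs) (there fx∈xs) (trans fy≡x (sym (inv (here refl))))))
      ...   | there fy∈xs =
              ∈-remove⁺ fy∈xs λ fy≡fx →
                All.lookup x∉xs y∈xs (sym (injective (there y∈xs) (here refl) fy≡fx))

allVecs : {B : Set} → List B → (k : ℕ) → List (Vec B k)
allVecs bs zero    = [] ∷ []
allVecs bs (suc k) = cartesianProductWith _∷_ bs (allVecs bs k)

∈-allVecs : {B : Set} {bs : List B} → (∀ b → b ∈ bs) → ∀ {k} (v : Vec B k) → v ∈ allVecs bs k
∈-allVecs ∈bs []      = here refl
∈-allVecs ∈bs (b ∷ v) = ∈-cartesianProductWith⁺ _∷_ (∈bs b) (∈-allVecs ∈bs v)

allMaybeFin : (n : ℕ) → List (Maybe (Fin n))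
allMaybeFin n = nothing ∷ map just (allFin n)

∈-allMaybeFin : ∀ {n} (a : Maybe (Fin n)) → a ∈ allMaybeFin n
∈-allMaybeFin nothing  = here refl
∈-allMaybeFin (just x) = there (∈-map⁺ just (∈-allFin x))

∃≢ : ∀ {n} → 2 ≤ n → (r : Fin n) → ∃ λ v → v ≢ r
∃≢ (s≤s (s≤s _)) zero    = suc zero , λ ()
∃≢ (s≤s (s≤s _)) (suc _) = zero , λ ()

x∈p─q⇒x∉q : ∀ {m} (p q : Subset m) {x} → x ∈ₛ p ─ q → x ∉ₛ q
x∈p─q⇒x∉q (_ ∷ p) (outside ∷ q) here        = λ ()
x∈p─q⇒x∉q (_ ∷ p) (_       ∷ q) (there x∈) (there x∈q) = x∈p─q⇒x∉q p q x∈ x∈q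

x∈p-y⇒x≢y : ∀ {m} {p : Subset m} {x y} → x ∈ₛ p - y → x ≢ y
x∈p-y⇒x≢y {p = p} {x} x∈ refl = x∈p─q⇒x∉q p ⁅ x ⁆ x∈ (x∈⁅x⁆ x)

x∈⊤-y : ∀ {m} {x y : Fin m} → x ≢ y → x ∈ₛ ⊤ - y
x∈⊤-y = x∈p∧x≢y⇒x∈p-y ∈⊤

allSubset? : ∀ {m} {P : Subset m → Set} → (∀ C → Dec (P C)) → Dec (∀ C → P C)
allSubset? P? with anySubset? (¬? ∘ P?)
... | yes (C , ¬PC) = no (λ ∀P → ¬PC (∀P C))
... | no ∄¬P = yes (λ C → decidable-stable (P? C) (λ ¬PC → ∄¬P (C , ¬PC)))

module _ {n : ℕ} (G : Graph n) where

  _≟ᴹ_ : DecidableEquality (Maybe (Fin n))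
  _≟ᴹ_ = Maybe.≡-dec _≟_

  Reach-source : ∀ {S u v} → Reach G S u v → u ∈ₛ S
  Reach-source (here u∈S)     = u∈S
  Reach-source (step u∈S _ _) = u∈S

  Reach-target : ∀ {S u v} → Reach G S u v → v ∈ₛ S
  Reach-target (here v∈S)     = v∈S
  Reach-target (step _ _ w⇝v) = Reach-target w⇝v

  Reach-mono : ∀ {S T u v} → S ⊆ T → Reach G S u v → Reach G T u v
  Reach-mono S⊆T (here u∈S)        = here (S⊆T u∈S)
  Reach-mono S⊆T (step u∈S uw w⇝v) = step (S⊆T u∈S) uw (Reach-mono S⊆T w⇝v)

  Reach-trans : ∀ {S u w v} → Reach G S u w → Reach G S w v → Reach G S u v
  Reach-trans (here _)          w⇝v = w⇝v
  Reach-trans (step u∈S ux x⇝w) w⇝v = step u∈S ux (Reach-trans x⇝w w⇝v)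

  Reach-snoc : ∀ {S u w v} → Reach G S u w → adj G w v ≡ true → v ∈ₛ S → Reach G S u v
  Reach-snoc u⇝w wv v∈S = Reach-trans u⇝w (step (Reach-target u⇝w) wv (here v∈S))

  Reach-sym : ∀ {S u v} → Reach G S u v → Reach G S v u
  Reach-sym (here u∈S) = here u∈S
  Reach-sym {u = u} (step {w = w} u∈S uw w⇝v) = Reach-snoc (Reach-sym w⇝v) (trans (Graph.sym G w u) uw) u∈S

  -- Either the path avoids u, or its part after the last visit of u starts at a neighbour of u.
  Reach-split : ∀ {S u w v} → u ≢ v → Reach G S w v →
                Reach G (S - u) w v ⊎ ∃ λ w′ → adj G u w′ ≡ true × Reach G (S - u) w′ v
  Reach-split u≢v (here v∈S) = inj₁ (here (x∈p∧x≢y⇒x∈p-y v∈S (u≢v ∘ sym)))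
  Reach-split {u = u} u≢v (step {u = w} {w = x} w∈S wx x⇝v) with Reach-split u≢v x⇝v
  ... | inj₂ later = inj₂ later
  ... | inj₁ x⇝v′ with w ≟ u
  ...   | yes refl = inj₂ (x , wx , x⇝v′)
  ...   | no w≢u   = inj₁ (step (x∈p∧x≢y⇒x∈p-y w∈S w≢u) wx x⇝v′)

  Reach?′ : ∀ S → Acc _⊂_ S → ∀ u v → Dec (Reach G S u v)
  Reach?′ S (acc rec) u v with u ∈? S | u ≟ v
  ... | no u∉S  | _        = no (u∉S ∘ Reach-source)
  ... | yes u∈S | yes refl = yes (here u∈S)
  ... | yes u∈S | no u≢v   = map′ viaNeighbour fromPath
          (any? λ w → (adj G u w Bool.≟ true) ×-dec Reach?′ (S - u) (rec (x∈p⇒p-x⊂p u∈S)) w v)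
    where
      viaNeighbour : (∃ λ w → adj G u w ≡ true × Reach G (S - u) w v) → Reach G S u v
      viaNeighbour (w , uw , w⇝v) = step u∈S uw (Reach-mono (p─q⊆p S ⁅ u ⁆) w⇝v)
      fromPath : Reach G S u v → ∃ λ w → adj G u w ≡ true × Reach G (S - u) w v
      fromPath (here _)         = ⊥-elim (u≢v refl)
      fromPath (step _ uw w⇝v) = [ (λ w⇝v′ → _ , uw , w⇝v′) , id ]′ (Reach-split u≢v w⇝v)

  Reach? : ∀ S u v → Dec (Reach G S u v)
  Reach? S = Reach?′ S (⊂-wellFounded S)

  Connected? : ∀ S → Dec (Connected G S)
  Connected? S = all? λ u → all? λ v → (u ∈? S) →-dec ((v ∈? S) →-dec Reach? S u v)

  IsComponent? : ∀ S C → Dec (IsComponent G S C)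
  IsComponent? S C = (C ⊆? S) ×-dec any? (_∈? C) ×-dec Connected? C ×-dec
    (all? λ u → all? λ v →
      (u ∈? C) →-dec (v ∈? S) →-dec (¬? (v ∈? C)) →-dec (adj G u v Bool.≟ false))

  component : Subset n → Fin n → Subset n
  component T v = tabulate (does ∘ Reach? T v)

  ∈-component⁺ : ∀ {T v u} → Reach G T v u → u ∈ₛ component T v
  ∈-component⁺ {T} {v} {u} v⇝u =
    lookup⇒[]= u _ (trans (lookup∘tabulate _ u) (dec-true (Reach? T v u) v⇝u))

  ∈-component⁻ : ∀ {T v u} → u ∈ₛ component T v → Reach G T v u
  ∈-component⁻ {T} {v} {u} u∈ =
    fromDoes (Reach? T v u) (trans (sym (lookup∘tabulate _ u)) ([]=⇒lookup u∈))
    where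
      fromDoes : (d : Dec (Reach G T v u)) → does d ≡ true → Reach G T v u
      fromDoes (yes v⇝u) _ = v⇝u
      fromDoes (no _)    ()

  Reach-component : ∀ {T v a b} → Reach G T v a → Reach G T a b → Reach G (component T v) a b
  Reach-component v⇝a (here _)          = here (∈-component⁺ v⇝a)
  Reach-component v⇝a (step _ ax x⇝b) =
    step (∈-component⁺ v⇝a) ax (Reach-component (Reach-snoc v⇝a ax (Reach-source x⇝b)) x⇝b)

  component-isComponent : ∀ {T v} → v ∈ₛ T → IsComponent G T (component T v)
  component-isComponent {T} {v} v∈T =
    Reach-target ∘ reach , (v , ∈-component⁺ (here v∈T)) , connected , closed
    where
      reach : ∀ {u} → u ∈ₛ component T v → Reach G T v u
      reach = ∈-component⁻
      connected : Connected G (component T v)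
      connected a b a∈ b∈ = Reach-component (reach a∈) (Reach-trans (Reach-sym (reach a∈)) (reach b∈))
      closed : ∀ a b → a ∈ₛ component T v → b ∈ₛ T → b ∉ₛ component T v → adj G a b ≡ false
      closed a b a∈ b∈T b∉ = decidable-stable (adj G a b Bool.≟ false)
        (λ ab≢false → b∉ (∈-component⁺ (Reach-snoc (reach a∈) (Bool.¬-not ab≢false) b∈T)))

  connected⇒isComponent : ∀ {S v} → Connected G S → v ∈ₛ S → IsComponent G S S
  connected⇒isComponent conn v∈S = id , (_ , v∈S) , conn , λ _ _ _ w∈S w∉S → ⊥-elim (w∉S w∈S)

  connected⇒component≡ : ∀ {S C} → Connected G S → IsComponent G S C → C ≡ S
  connected⇒component≡ {S} {C} conn (C⊆S , (x , x∈C) , _ , closed) =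
    ⊆-antisym C⊆S (λ y∈S → stays (conn _ _ (C⊆S x∈C) y∈S) x∈C)
    where
      stays : ∀ {a b} → Reach G S a b → a ∈ₛ C → b ∈ₛ C
      stays (here _) a∈C = a∈C
      stays {a} (step {w = w} _ aw w⇝b) a∈C with w ∈? C
      ... | yes w∈C = stays w⇝b w∈C
      ... | no w∉C with trans (sym aw) (closed a w a∈C (Reach-source w⇝b) w∉C)
      ...   | ()

  Subtree : ParentVec G → Fin n → Subset n → Set
  Subtree p r C = Σ (Fin n) λ c → c ∈ₛ C × lookup p c ≡ just r × ET G C c p

  ET?′ : ∀ p S → Acc _⊂_ S → ∀ r → Dec (ET G S r p)
  ET?′ p S (acc rec) r with r ∈? S
  ... | no r∉S  = no λ { (node r∈S _) → r∉S r∈S }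
  ... | yes r∈S = map′ (node r∈S) (λ { (node _ subtrees) → subtrees }) (allSubset? subtree?)
    where
      subtree? : ∀ C → Dec (IsComponent G (S - r) C → Subtree p r C)
      subtree? C with IsComponent? (S - r) C
      ... | no ¬isC = yes (⊥-elim ∘ ¬isC)
      ... | yes isC = map′ const (_$ isC) (any? λ c →
              (c ∈? C) ×-dec (lookup p c ≟ᴹ just r) ×-dec
              ET?′ p C (rec (⊆-⊂-trans (proj₁ isC) (x∈p⇒p-x⊂p r∈S))) c)

  ElimTree? : ∀ p → Dec (ElimTree G p)
  ElimTree? p = any? λ r → (lookup p r ≟ᴹ nothing) ×-dec ET?′ p ⊤ (⊂-wellFounded ⊤) r

  ET-parent : ∀ {p S r} → ET G S r p → ∀ {v} → v ∈ₛ S → v ≢ r →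
              ∃ λ w → lookup p v ≡ just w × w ∈ₛ S
  ET-parent {p} {S} {r} (node r∈S subtrees) {v} v∈S v≢r =
    parentIn (component-isComponent v∈S-r) (∈-component⁺ (here v∈S-r))
             (subtrees _ (component-isComponent v∈S-r))
    where
      v∈S-r : v ∈ₛ S - r
      v∈S-r = x∈p∧x≢y⇒x∈p-y v∈S v≢r
      parentIn : ∀ {C} → IsComponent G (S - r) C → v ∈ₛ C → Subtree p r C →
                 ∃ λ w → lookup p v ≡ just w × w ∈ₛ S
      parentIn (C⊆S-r , _) v∈C (c , _ , pc≡r , subtree) with v ≟ c
      ... | yes refl = r , pc≡r , r∈S
      ... | no v≢c with ET-parent subtree v∈C v≢c
      ...   | w , pv≡w , w∈C = w , pv≡w , p─q⊆p S ⁅ r ⁆ (C⊆S-r w∈C)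

  ET-cong : ∀ {p p′ S r} → ET G S r p → (∀ {v} → v ∈ₛ S - r → lookup p′ v ≡ lookup p v) →
            ET G S r p′
  ET-cong {p} {p′} {S} {r} (node r∈S subtrees) agree =
    node r∈S λ C isC → cong-subtree C isC (subtrees C isC)
    where
      cong-subtree : ∀ C → IsComponent G (S - r) C → Subtree p r C → Subtree p′ r C
      cong-subtree C (C⊆S-r , _) (c , c∈C , pc≡r , subtree) =
        c , c∈C , trans (agree (C⊆S-r c∈C)) pc≡r ,
        ET-cong subtree (λ v∈C-c → agree (C⊆S-r (p─q⊆p C ⁅ c ⁆ v∈C-c)))

  reparent : Fin n → Fin n → ParentVec G → Fin n → Maybe (Fin n)
  reparent r c p v =
    if does (v ≟ c) then nothing
    else if does (v ≟ r) then just c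
    else if does (lookup p v ≟ᴹ just c) then just r
    else lookup p v

  reroot : Fin n → Fin n → ParentVec G → ParentVec G
  reroot r c p = tabulate (reparent r c p)

  reroot-new-root : ∀ {r c} p → lookup (reroot r c p) c ≡ nothing
  reroot-new-root {r} {c} p rewrite lookup∘tabulate (reparent r c p) c | dec-true (c ≟ c) refl = refl

  reroot-old-root : ∀ {r c} p → r ≢ c → lookup (reroot r c p) r ≡ just c
  reroot-old-root {r} {c} p r≢c
    rewrite lookup∘tabulate (reparent r c p) r | dec-false (r ≟ c) r≢c | dec-true (r ≟ r) refl = refl

  reroot-grandchild : ∀ {r c v} p → v ≢ c → v ≢ r → lookup p v ≡ just c →
                      lookup (reroot r c p) v ≡ just r
  reroot-grandchild {r} {c} {v} p v≢c v≢r pv≡c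
    rewrite lookup∘tabulate (reparent r c p) v | dec-false (v ≟ c) v≢c | dec-false (v ≟ r) v≢r
          | dec-true (lookup p v ≟ᴹ just c) pv≡c = refl

  reroot-other : ∀ {r c v} p → v ≢ c → v ≢ r → lookup p v ≢ just c →
                 lookup (reroot r c p) v ≡ lookup p v
  reroot-other {r} {c} {v} p v≢c v≢r pv≢c
    rewrite lookup∘tabulate (reparent r c p) v | dec-false (v ≟ c) v≢c | dec-false (v ≟ r) v≢r
          | dec-false (lookup p v ≟ᴹ just c) pv≢c = refl

  TopEdge : ParentVec G → Fin n → Fin n → Set
  TopEdge p r c = lookup p r ≡ nothing × lookup p c ≡ just r × ET G (⊤ - r) c p

  TopEdge⇒≢ : ∀ {p r c} → TopEdge p r c → r ≢ c
  TopEdge⇒≢ (pr≡nothing , pc≡r , _) refl with trans (sym pr≡nothing) pc≡r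
  ... | ()

  TopEdge-parent : ∀ {p r c v} → TopEdge p r c → v ≢ r → v ≢ c →
                   ∃ λ w → lookup p v ≡ just w × w ∈ₛ ⊤ - r
  TopEdge-parent (_ , _ , subtree) v≢r = ET-parent subtree (x∈⊤-y v≢r)

  TopEdge-root-unique : ∀ {p r c v} → TopEdge p r c → lookup p v ≡ nothing → v ≡ r
  TopEdge-root-unique {r = r} {c} {v} t pv≡nothing with v ≟ r | v ≟ c
  ... | yes v≡r | _        = v≡r
  ... | no _    | yes refl with trans (sym pv≡nothing) (proj₁ (proj₂ t))
  ...   | ()
  TopEdge-root-unique t pv≡nothing | no v≢r | no v≢c with TopEdge-parent t v≢r v≢c
  ...   | _ , pv≡w , _ with trans (sym pv≡nothing) pv≡w
  ...     | ()

  TopEdge-child-unique : ∀ {p r c v} → TopEdge p r c → lookup p v ≡ just r → v ≡ c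
  TopEdge-child-unique {r = r} {c} {v} t pv≡r with v ≟ c | v ≟ r
  ... | yes v≡c | _        = v≡c
  ... | no _    | yes refl with trans (sym (proj₁ t)) pv≡r
  ...   | ()
  TopEdge-child-unique t pv≡r | no v≢c | no v≢r with TopEdge-parent t v≢r v≢c
  ...   | _ , pv≡w , w∈⊤-r =
          ⊥-elim (x∈p-y⇒x≢y w∈⊤-r (Maybe.just-injective (trans (sym pv≡w) pv≡r)))

  reroot-TopEdge : ∀ {p r c} → TopEdge p r c → TopEdge (reroot r c p) c r
  reroot-TopEdge {p} {r} {c} t@(_ , _ , node _ subtrees) =
    reroot-new-root p , reroot-old-root p r≢c , node (x∈⊤-y r≢c) subtree′
    where
      r≢c : r ≢ c
      r≢c = TopEdge⇒≢ t
      subtree′ : ∀ C → IsComponent G (⊤ - c - r) C → Subtree (reroot r c p) r C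
      subtree′ C isC with subst (λ S → IsComponent G S C) (p─x─y≡p─y─x ⊤ c r) isC
      ... | isC′@(C⊆ , _) with subtrees C isC′
      ...   | c′ , c′∈C , pc′≡c , subtree =
              c′ , c′∈C , reroot-grandchild p (≢c c′∈C) (≢r c′∈C) pc′≡c ,
              ET-cong subtree agree
        where
          ≢r : ∀ {u} → u ∈ₛ C → u ≢ r
          ≢r = x∈p-y⇒x≢y ∘ p─q⊆p (⊤ - r) ⁅ c ⁆ ∘ C⊆
          ≢c : ∀ {u} → u ∈ₛ C → u ≢ c
          ≢c = x∈p-y⇒x≢y ∘ C⊆
          agree : ∀ {v} → v ∈ₛ C - c′ → lookup (reroot r c p) v ≡ lookup p v
          agree v∈C-c′ with ET-parent subtree (p─q⊆p C ⁅ c′ ⁆ v∈C-c′) (x∈p-y⇒x≢y v∈C-c′)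
          ... | w , pv≡w , w∈C = reroot-other p (≢c v∈C) (≢r v∈C)
                  (≢c w∈C ∘ Maybe.just-injective ∘ trans (sym pv≡w))
            where
              v∈C : _ ∈ₛ C
              v∈C = p─q⊆p C ⁅ c′ ⁆ v∈C-c′

  reroot-involutive : ∀ {p r c} → TopEdge p r c → reroot c r (reroot r c p) ≡ p
  reroot-involutive {p} {r} {c} t@(pr≡nothing , pc≡r , _) =
    trans (tabulate-cong λ v → trans (sym (lookup∘tabulate (reparent c r p′) v)) (same v))
          (tabulate∘lookup p)
    where
      p′ : ParentVec G
      p′ = reroot r c p
      r≢c : r ≢ c
      r≢c = TopEdge⇒≢ t
      same : ∀ v → lookup (reroot c r p′) v ≡ lookup p v
      same v with v ≟ r | v ≟ c
      ... | yes refl | _        = trans (reroot-new-root p′) (sym pr≡nothing)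
      ... | no _     | yes refl = trans (reroot-old-root p′ (r≢c ∘ sym)) (sym pc≡r)
      ... | no v≢r   | no v≢c with TopEdge-parent t v≢r v≢c
      ...   | w , pv≡w , w∈⊤-r with w ≟ c
      ...     | yes refl =
                trans (reroot-grandchild p′ v≢r v≢c (reroot-grandchild p v≢c v≢r pv≡w)) (sym pv≡w)
      ...     | no w≢c = trans (reroot-other p′ v≢r v≢c p′v≢r) p′v≡pv
        where
          p′v≡pv : lookup p′ v ≡ lookup p v
          p′v≡pv = reroot-other p v≢c v≢r (w≢c ∘ Maybe.just-injective ∘ trans (sym pv≡w))
          p′v≢r : lookup p′ v ≢ just r
          p′v≢r = x∈p-y⇒x≢y w∈⊤-r ∘ Maybe.just-injective
                ∘ trans (sym pv≡w) ∘ trans (sym p′v≡pv)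

  flipRoot : ParentVec G → ParentVec G
  flipRoot p with any? (λ v → lookup p v ≟ᴹ nothing)
  ... | no _       = p
  ... | yes (r , _) with any? (λ v → lookup p v ≟ᴹ just r)
  ...   | no _       = p
  ...   | yes (c , _) = reroot r c p

  flipRoot-TopEdge : ∀ {p r c} → TopEdge p r c → flipRoot p ≡ reroot r c p
  flipRoot-TopEdge {p} {r} t with any? (λ v → lookup p v ≟ᴹ nothing)
  ... | no ∄root = ⊥-elim (∄root (_ , proj₁ t))
  ... | yes (_ , pr≡nothing) with TopEdge-root-unique t pr≡nothing
  ...   | refl with any? (λ v → lookup p v ≟ᴹ just r)
  ...     | no ∄child = ⊥-elim (∄child (_ , proj₁ (proj₂ t)))
  ...     | yes (_ , pc≡r) with TopEdge-child-unique t pc≡r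
  ...       | refl = refl

  module _ (2-connected : TwoConnected G) where
    open ≡-Reasoning

    ElimTree⇒TopEdge : ∀ {p} → ElimTree G p → ∃₂ λ r c → TopEdge p r c
    ElimTree⇒TopEdge (r , pr≡nothing , node _ subtrees)
      with ∃≢ (≤-trans (n≤1+n 2) (proj₁ 2-connected)) r
    ... | v , v≢r with subtrees (⊤ - r) (connected⇒isComponent (proj₂ 2-connected r) (x∈⊤-y v≢r))
    ...   | c , _ , pc≡r , subtree = r , c , pr≡nothing , pc≡r , subtree

    TopEdge⇒ElimTree : ∀ {p r c} → TopEdge p r c → ElimTree G p
    TopEdge⇒ElimTree {p} {r} {c} t@(pr≡nothing , pc≡r , subtree) =
      r , pr≡nothing , node ∈⊤ λ C isC →
        subst (Subtree p r) (sym (connected⇒component≡ (proj₂ 2-connected r) isC))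
              (c , x∈⊤-y (TopEdge⇒≢ t ∘ sym) , pc≡r , subtree)

    flipRoot-ElimTree : ∀ {p} → ElimTree G p → ElimTree G (flipRoot p)
    flipRoot-ElimTree tree with ElimTree⇒TopEdge tree
    ... | _ , _ , t = subst (ElimTree G) (sym (flipRoot-TopEdge t)) (TopEdge⇒ElimTree (reroot-TopEdge t))

    flipRoot-involutive : ∀ {p} → ElimTree G p → flipRoot (flipRoot p) ≡ p
    flipRoot-involutive {p} tree with ElimTree⇒TopEdge tree
    ... | r , c , t = begin
      flipRoot (flipRoot p)     ≡⟨ cong flipRoot (flipRoot-TopEdge t) ⟩
      flipRoot (reroot r c p)   ≡⟨ flipRoot-TopEdge (reroot-TopEdge t) ⟩
      reroot c r (reroot r c p) ≡⟨ reroot-involutive t ⟩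
      p                         ∎

    flipRoot-≢ : ∀ {p} → ElimTree G p → flipRoot p ≢ p
    flipRoot-≢ {p} tree flip≡p with ElimTree⇒TopEdge tree
    ... | r , c , t@(_ , pc≡r , _) with begin
          nothing                 ≡⟨ reroot-new-root p ⟨
          lookup (reroot r c p) c ≡⟨ cong (λ q → lookup q c) (flipRoot-TopEdge t) ⟨
          lookup (flipRoot p) c   ≡⟨ cong (λ q → lookup q c) flip≡p ⟩
          lookup p c              ≡⟨ pc≡r ⟩
          just r                  ∎
    ...   | ()

  _≟ᴾ_ : DecidableEquality (ParentVec G)
  _≟ᴾ_ = Vec.≡-dec _≟ᴹ_

  elimTrees : List (ParentVec G)
  elimTrees = filter ElimTree? (deduplicate _≟ᴾ_ (allVecs (allMaybeFin n) n))

  elimTrees-unique : Unique elimTrees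
  elimTrees-unique = filter⁺ ElimTree? (deduplicate-! _≟ᴾ_ (allVecs (allMaybeFin n) n))

  ∈-elimTrees⁺ : ∀ p → ElimTree G p → p ∈ elimTrees
  ∈-elimTrees⁺ p = ∈-filter⁺ ElimTree? (∈-deduplicate⁺ _≟ᴾ_ (∈-allVecs ∈-allMaybeFin p))

  ∈-elimTrees⁻ : ∀ p → p ∈ elimTrees → ElimTree G p
  ∈-elimTrees⁻ p = proj₂ ∘ ∈-filter⁻ ElimTree? {xs = deduplicate _≟ᴾ_ (allVecs (allMaybeFin n) n)}

lemma30 : (n : ℕ) (G : Graph n) → TwoConnected G →
    Σ (List (ParentVec G)) λ L →
      Unique L × (∀ p → ElimTree G p → p ∈ L) × (∀ p → p ∈ L → ElimTree G p) ×
      (2 ∣ length L)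
lemma30 n G 2-connected =
  elimTrees G , elimTrees-unique G , ∈-elimTrees⁺ G , ∈-elimTrees⁻ G ,
  involution-2∣length (_≟ᴾ_ G) (flipRoot G) _ refl (elimTrees-unique G)
    (∈-elimTrees⁺ G _ ∘ flipRoot-ElimTree G 2-connected ∘ tree)
    (flipRoot-involutive G 2-connected ∘ tree)
    (flipRoot-≢ G 2-connected ∘ tree)
  where
    tree : ∀ {p} → p ∈ elimTrees G → ElimTree G p
    tree = ∈-elimTrees⁻ G _
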